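{- Let $T=(V,\mathcal{E})$ be a tree with a designated root $r$, and let $E$ be a set of links on $V$ that is closed under shadows. Let $F$ be a shadows-minimal cover of $T$ by links of $E$ that has minimum size, and that among all minimum-size shadows-minimal covers has the maximum number of twin links. Then every leaf $a$ of $T$ is incident to exactly one link of $F$, i.e., $d_F(a)=1$.
   Context: For nodes $u,v$ of the tree $T$, $P(uv)$ is the path in $T$ between $u$ and $v$; a link $uv$ covers the edges of $P(uv)$. A cover of $T$ is a set of links covering all tree edges. A link $u'v'$ is a shadow of $uv$ if $P(u'v')\subseteq P(uv)$; it is a proper shadow if in addition $u'v'\neq uv$. $E$ is closed under shadows if every shadow of a link of $E$ is in $E$. An inclusion-minimal cover $F$ is shadows-minimal if, for every $uv\in F$, replacing $uv$ by any proper shadow of it yields a set that does not cover $T$. Leaves of $T$ are the nodes other than $r$ with no descendants. A link between leaves $a,b$ is a twin link if contracting $P(ab)$ into a single node yields a new leaf. $d_F(x)$ is the number of links of $F$ incident to $x$. -}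

module Defs where

open import Data.Nat using (ℕ; zero; suc; _<_; _≤_)
open import Data.Fin using (Fin; toℕ) renaming (_≟_ to _≟F_)
open import Data.Product using (Σ; ∃; _×_; _,_)
open import Data.Sum using (_⊎_)
open import Data.List using (List; length; filter)
open import Data.List.Membership.Propositional using (_∈_)
open import Data.List.Relation.Unary.All using (All)
open import Data.List.Relation.Unary.Unique.Propositional using (Unique)
open import Relation.Nullary using (¬_)
open import Relation.Nullary.Decidable using (_⊎-dec_)
open import Relation.Binary.PropositionalEquality using (_≡_; _≢_)

-- A rooted tree on the node set Fin n, given by its root and parent map.
-- parent r ≡ r, and every non-root node v has depth one more than its
-- parent, so iterating parent from any node reaches r (acyclic, connected).
-- The tree edges are {v , parent v} for v ≢ r; we name the edge by its
-- child endpoint v.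
record RootedTree (n : ℕ) : Set where
  field
    root       : Fin n
    parent     : Fin n → Fin n
    depth      : Fin n → ℕ
    parent-root : parent root ≡ root
    depth-dec  : ∀ v → v ≢ root → depth v ≡ suc (depth (parent v))
open RootedTree public

iter : ∀ {A : Set} → (A → A) → ℕ → A → A
iter f zero x = x
iter f (suc k) x = f (iter f k x)

Anc : ∀ {n} → RootedTree n → Fin n → Fin n → Set
Anc T w u = ∃ λ k → iter (parent T) k u ≡ w

IsEdge : ∀ {n} → RootedTree n → Fin n → Set
IsEdge T w = w ≢ root T

-- the edge w (child endpoint w) lies on the tree path P(uv):
-- exactly one of u, v lies in the subtree below that edge
EdgeOnPath : ∀ {n} → RootedTree n → Fin n → Fin n → Fin n → Set
EdgeOnPath T w u v = IsEdge T w × ((Anc T w u × ¬ Anc T w v) ⊎ (Anc T w v × ¬ Anc T w u))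

-- node x lies on P(uv) (for u ≢ v): x is an endpoint of some edge of P(uv)
NodeOnPath : ∀ {n} → RootedTree n → Fin n → Fin n → Fin n → Set
NodeOnPath T x u v = ∃ λ w → EdgeOnPath T w u v × (x ≡ w ⊎ x ≡ parent T w)

-- a link: an unordered pair {u,v} of distinct nodes, stored with u < v
record Link (n : ℕ) : Set where
  constructor link
  field
    lu  : Fin n
    lv  : Fin n
    ord : toℕ lu < toℕ lv
open Link public

Covers : ∀ {n} → RootedTree n → Link n → Fin n → Set
Covers T l w = EdgeOnPath T w (lu l) (lv l)

IsCover : ∀ {n} → RootedTree n → (Link n → Set) → Set
IsCover T S = ∀ w → IsEdge T w → ∃ λ l → S l × Covers T l w

Shadow : ∀ {n} → RootedTree n → Link n → Link n → Set
Shadow T l' l = ∀ w → Covers T l' w → Covers T l w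

ProperShadow : ∀ {n} → RootedTree n → Link n → Link n → Set
ProperShadow T l' l = Shadow T l' l × l' ≢ l

ClosedUnderShadows : ∀ {n} → RootedTree n → (Link n → Set) → Set
ClosedUnderShadows T E = ∀ l l' → E l → Shadow T l' l → E l'

-- sets of links are duplicate-free lists
InclusionMinimalCover : ∀ {n} → RootedTree n → List (Link n) → Set
InclusionMinimalCover T F =
  IsCover T (_∈ F) × (∀ l → l ∈ F → ¬ IsCover T (λ l' → l' ∈ F × l' ≢ l))

ShadowsMinimalCover : ∀ {n} → RootedTree n → (Link n → Set) → List (Link n) → Set
ShadowsMinimalCover T E F =
  Unique F × All E F × InclusionMinimalCover T F ×
  (∀ l → l ∈ F → ∀ l' → ProperShadow T l' l →
     ¬ IsCover T (λ l'' → (l'' ∈ F × l'' ≢ l) ⊎ l'' ≡ l'))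

Leaf : ∀ {n} → RootedTree n → Fin n → Set
Leaf T a = a ≢ root T × (∀ x → x ≢ root T → parent T x ≢ a)

-- twin link: between two leaves, and contracting P(ab) into a single node
-- yields a leaf, i.e. the contracted node is not the root (r ∉ P(ab)) and
-- has no children (every child of a node of P(ab) lies on P(ab)).
TwinLink : ∀ {n} → RootedTree n → Link n → Set
TwinLink T l =
  Leaf T (lu l) × Leaf T (lv l) ×
  ¬ NodeOnPath T (root T) (lu l) (lv l) ×
  (∀ x → x ≢ root T → NodeOnPath T (parent T x) (lu l) (lv l) →
     NodeOnPath T x (lu l) (lv l))

AtLeastTwins : ∀ {n} → RootedTree n → List (Link n) → ℕ → Set
AtLeastTwins {n} T F k =
  ∃ λ (L : List (Link n)) → Unique L × (∀ l → l ∈ L → l ∈ F × TwinLink T l) × length L ≡ k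

Incident : ∀ {n} → Fin n → Link n → Set
Incident x l = x ≡ lu l ⊎ x ≡ lv l

deg : ∀ {n} → List (Link n) → Fin n → ℕ
deg F x = length (filter (λ l → (x ≟F lu l) ⊎-dec (x ≟F lv l)) F)

module Submission where

-- The argument only uses that F
-- is a shadows-minimal cover.  The leaf edge a is covered by a link iff the link has a as an
-- endpoint, so at least one link of F meets a.  If two distinct links l₁, l₂
-- of F met a, write l₁ = {a, u}.  Apart from the edge a, the path P(au)
-- coincides with P(p a, u), where p is the parent map.  Hence l₁ can be
-- trimmed: if p a = u, then F ∖ {l₁} is still a cover (the edge a is covered
-- by l₂), which contradicts inclusion-minimality; otherwise replacing l₁ by
-- the proper shadow {p a, u} still gives a cover, which contradicts
-- shadows-minimality.

open import Defs
open import Data.Nat using (zero; suc; _≤_)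
open import Data.Nat.Properties using (<-cmp; <-irrelevant; <-irrefl)
open import Data.Fin using (Fin; toℕ) renaming (_≟_ to _≟F_)
open import Data.Fin.Properties using (toℕ-injective)
open import Data.List using (List; []; _∷_; length; filter)
open import Data.List.Membership.Propositional using (_∈_)
open import Data.List.Membership.Propositional.Properties using (∈-filter⁺; ∈-filter⁻)
open import Data.List.Relation.Unary.Any using (here; there)
open import Data.List.Relation.Unary.AllPairs using (_∷_)
open import Data.List.Relation.Unary.All using (_∷_)
open import Data.List.Relation.Unary.Unique.Propositional using (Unique)
open import Data.List.Relation.Unary.Unique.Propositional.Properties using (filter⁺)
open import Data.Product using (∃; _×_; _,_; proj₁; proj₂)
open import Data.Sum using (_⊎_; inj₁; inj₂)
open import Data.Empty using (⊥-elim)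
open import Relation.Nullary using (¬_; Dec; yes; no)
open import Relation.Nullary.Decidable using (_⊎-dec_)
open import Relation.Binary using (tri<; tri≈; tri>)
open import Relation.Binary.PropositionalEquality
  using (_≡_; _≢_; refl; sym; trans; cong; subst)

iter-suc : ∀ {A : Set} (f : A → A) k x → iter f (suc k) x ≡ iter f k (f x)
iter-suc f zero    x = refl
iter-suc f (suc k) x = cong f (iter-suc f k x)

module _ {n} (T : RootedTree n) where

  private
    p : Fin n → Fin n
    p = parent T

  Spans : Link n → Fin n → Fin n → Set
  Spans l x y =
    (∀ w → Covers T l w → EdgeOnPath T w x y) × (∀ w → EdgeOnPath T w x y → Covers T l w)

  anc-up : ∀ {w x} → w ≢ x → Anc T w x → Anc T w (p x)
  anc-up w≢x (zero  , eq) = ⊥-elim (w≢x (sym eq))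
  anc-up {x = x} _ (suc k , eq) = k , trans (sym (iter-suc p k x)) eq

  anc-down : ∀ {w x} → Anc T w (p x) → Anc T w x
  anc-down {x = x} (k , eq) = suc k , trans (iter-suc p k x) eq

  edge-transfer : ∀ {w x x' y} → (Anc T w x → Anc T w x') → (Anc T w x' → Anc T w x) →
    EdgeOnPath T w x y → EdgeOnPath T w x' y
  edge-transfer f g (e , inj₁ (wx , ¬wy)) = e , inj₁ (f wx , ¬wy)
  edge-transfer f g (e , inj₂ (wy , ¬wx)) = e , inj₂ (wy , λ wx' → ¬wx (g wx'))

  edge-up : ∀ {w x y} → w ≢ x → EdgeOnPath T w x y → EdgeOnPath T w (p x) y
  edge-up w≢x = edge-transfer (anc-up w≢x) anc-down

  edge-down : ∀ {w x y} → w ≢ x → EdgeOnPath T w (p x) y → EdgeOnPath T w x y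
  edge-down w≢x = edge-transfer anc-down (anc-up w≢x)

  edge-sym : ∀ {w x y} → EdgeOnPath T w x y → EdgeOnPath T w y x
  edge-sym (e , inj₁ q) = e , inj₂ q
  edge-sym (e , inj₂ q) = e , inj₁ q

  edge-irrefl : ∀ {w x} → ¬ EdgeOnPath T w x x
  edge-irrefl (_ , inj₁ (wx , ¬wx)) = ¬wx wx
  edge-irrefl (_ , inj₂ (wx , ¬wx)) = ¬wx wx

  link-ends-distinct : (l : Link n) → lu l ≢ lv l
  link-ends-distinct l eq = <-irrefl (cong toℕ eq) (ord l)

  other-end : ∀ {x} l → Incident x l → ∃ λ o → o ≢ x × Spans l x o
  other-end l (inj₁ refl) =
    lv l , (λ e → link-ends-distinct l (sym e)) , (λ w c → c) , (λ w c → c)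
  other-end l (inj₂ refl) =
    lu l , link-ends-distinct l , (λ w c → edge-sym c) , (λ w c → edge-sym c)

  link-between : ∀ x y → x ≢ y →
    ∃ λ l → Spans l x y × (∀ z → Incident z l → z ≡ x ⊎ z ≡ y)
  link-between x y x≢y with <-cmp (toℕ x) (toℕ y)
  ... | tri< x<y _ _ = link x y x<y , ((λ w c → c) , (λ w c → c)) , (λ z i → i)
  ... | tri≈ _ x≡y _ = ⊥-elim (x≢y (toℕ-injective x≡y))
  ... | tri> _ _ y<x = link y x y<x , ((λ w c → edge-sym c) , (λ w c → edge-sym c)) ,
        λ { z (inj₁ e) → inj₂ e ; z (inj₂ e) → inj₁ e }

  _≟L_ : (l m : Link n) → Dec (l ≡ m)
  link u v o ≟L link u' v' o' with u ≟F u' | v ≟F v'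
  ... | yes refl | yes refl = yes (cong (link u v) (<-irrelevant o o'))
  ... | no u≢u'  | _        = no λ eq → u≢u' (cong lu eq)
  ... | _        | no v≢v'  = no λ eq → v≢v' (cong lv eq)

  -- A leaf is nobody's parent; for the root this uses parent r ≡ r and a ≢ r.
  leaf-childless : ∀ {a} → Leaf T a → ∀ x → p x ≢ a
  leaf-childless {a} (a≢r , childless) x px≡a with x ≟F root T
  ... | no  x≢r  = childless x x≢r px≡a
  ... | yes refl = a≢r (trans (sym px≡a) (parent-root T))

  leaf-descendant : ∀ {a y} → Leaf T a → Anc T a y → y ≡ a
  leaf-descendant lf (zero  , eq) = eq
  leaf-descendant lf (suc k , eq) = ⊥-elim (leaf-childless lf _ eq)

  leaf-edge-off-path : ∀ {a x y} → Leaf T a → x ≢ a → y ≢ a → ¬ EdgeOnPath T a x y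
  leaf-edge-off-path lf x≢a _ (_ , inj₁ (ax , _)) = x≢a (leaf-descendant lf ax)
  leaf-edge-off-path lf _ y≢a (_ , inj₂ (ay , _)) = y≢a (leaf-descendant lf ay)

  covers-leaf⇒incident : ∀ {a} → Leaf T a → ∀ l → Covers T l a → Incident a l
  covers-leaf⇒incident lf l (_ , inj₁ (au , _)) = inj₁ (sym (leaf-descendant lf au))
  covers-leaf⇒incident lf l (_ , inj₂ (av , _)) = inj₂ (sym (leaf-descendant lf av))

  incident⇒covers-leaf : ∀ {a} → Leaf T a → ∀ l → Incident a l → Covers T l a
  incident⇒covers-leaf {a} lf l i with other-end l i
  ... | o , o≢a , _ , spans← =
    spans← a (proj₁ lf , inj₁ ((zero , refl) , λ ao → o≢a (leaf-descendant lf ao)))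

  cover-after-trim : ∀ {a u F l₁ l₂} (S : Link n → Set) → IsCover T (_∈ F) →
    Leaf T a → Spans l₁ a u → S l₂ → Incident a l₂ → (∀ l → l ∈ F → l ≢ l₁ → S l) →
    (∀ w → EdgeOnPath T w (p a) u → ∃ λ l → S l × Covers T l w) → IsCover T S
  cover-after-trim {a} {l₁ = l₁} {l₂} S cover lf (spans→ , _) Sl₂ l₂-at-a keep above w e
    with cover w e
  ... | l , l∈F , covers with l ≟L l₁
  ... | no l≢l₁ = l , keep l l∈F l≢l₁ , covers
  ... | yes refl with w ≟F a
  ... | yes refl = l₂ , Sl₂ , incident⇒covers-leaf lf l₂ l₂-at-a
  ... | no  w≢a  = above w (edge-up w≢a (spans→ w covers))

  leaf-link-unique : ∀ {E F a l₁ l₂} → ShadowsMinimalCover T E F → Leaf T a →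
    l₁ ∈ F → l₂ ∈ F → Incident a l₁ → Incident a l₂ → l₁ ≡ l₂
  leaf-link-unique {l₁ = l₁} {l₂} _ _ _ _ _ _ with l₁ ≟L l₂
  ... | yes l₁≡l₂ = l₁≡l₂
  leaf-link-unique {F = F} {a} {l₁} {l₂} (_ , _ , (cover , inclusion-min) , shadows-min)
    lf l₁∈F l₂∈F l₁-at-a l₂-at-a | no l₁≢l₂
    with other-end l₁ l₁-at-a
  ... | u , u≢a , spans₁ with p a ≟F u
  ... | yes pa≡u = ⊥-elim (inclusion-min l₁ l₁∈F
          (cover-after-trim _ cover lf spans₁ (l₂∈F , λ e → l₁≢l₂ (sym e)) l₂-at-a
             (λ l l∈F l≢l₁ → l∈F , l≢l₁)
             (λ w e → ⊥-elim (edge-irrefl (subst (λ x → EdgeOnPath T w x u) pa≡u e)))))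
  ... | no  pa≢u with link-between (p a) u pa≢u
  ... | l' , (spans'→ , spans'←) , ends' = ⊥-elim (shadows-min l₁ l₁∈F l' (shadow , proper)
          (cover-after-trim _ cover lf spans₁ (inj₁ (l₂∈F , λ e → l₁≢l₂ (sym e))) l₂-at-a
             (λ l l∈F l≢l₁ → inj₁ (l∈F , l≢l₁))
             (λ w e → l' , inj₂ refl , spans'← w e)))
    where
    pa≢a : p a ≢ a
    pa≢a = leaf-childless lf a

    -- l' = {p a, u} covers P(au) minus its leaf edge.
    shadow : Shadow T l' l₁
    shadow w c with w ≟F a
    ... | yes refl = ⊥-elim (leaf-edge-off-path lf pa≢a u≢a (spans'→ a c))
    ... | no  w≢a  = proj₂ spans₁ w (edge-down w≢a (spans'→ w c))

    -- a is an endpoint of l₁ but not of l'.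
    proper : l' ≢ l₁
    proper l'≡l₁ with ends' a (subst (Incident a) (sym l'≡l₁) l₁-at-a)
    ... | inj₁ a≡pa = pa≢a (sym a≡pa)
    ... | inj₂ a≡u  = u≢a (sym a≡u)

length-singleton : ∀ {A : Set} {x : A} (xs : List A) → Unique xs → x ∈ xs →
  (∀ y → y ∈ xs → y ≡ x) → length xs ≡ 1
length-singleton []           _                  ()  _
length-singleton (_ ∷ [])     _                  _   _    = refl
length-singleton (y ∷ z ∷ zs) ((y≢z ∷ _) ∷ _) _ same =
  ⊥-elim (y≢z (trans (same y (here refl)) (sym (same z (there (here refl))))))

claim2p6 : ∀ {n} (T : RootedTree n) (E : Link n → Set) →
    ClosedUnderShadows T E →
    (F : List (Link n)) →
    ShadowsMinimalCover T E F →
    (∀ F' → ShadowsMinimalCover T E F' → length F ≤ length F') →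
    (∀ F' → ShadowsMinimalCover T E F' → length F' ≡ length F →
    ∀ k → AtLeastTwins T F' k → AtLeastTwins T F k) →
    ∀ a → Leaf T a → deg F a ≡ 1
claim2p6 {n} T E _ F smc@(unique , _ , (cover , _) , _) _ _ a lf
  with cover a (proj₁ lf)
... | l , l∈F , covers-a =
  length-singleton (filter at-a? F) (filter⁺ at-a? unique) (∈-filter⁺ at-a? l∈F l-at-a) only-l
  where
  at-a? : (m : Link n) → Dec (Incident a m)
  at-a? m = (a ≟F lu m) ⊎-dec (a ≟F lv m)

  l-at-a : Incident a l
  l-at-a = covers-leaf⇒incident T lf l covers-a

  only-l : ∀ m → m ∈ filter at-a? F → m ≡ l
  only-l m m∈ with ∈-filter⁻ at-a? m∈
  ... | m∈F , m-at-a = leaf-link-unique T smc lf m∈F l∈F m-at-a l-at-a
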